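{- Let $G$ be a graph of order $n$ with maximum degree $\Delta(G)$, and let $k\ge\chi(G)$. Then $sn(G,k)=n$ if and only if $k\ge \Delta(G)+2$.
   Context: All graphs are finite, simple, undirected and connected. Let $G=(V,E)$ be a graph with chromatic number $\chi(G)$, let $k\ge\chi(G)$ and $S\subseteq V$. A proper $k$-coloring $C_0$ of the induced subgraph $G[S]$ is extendable if it extends to a proper $k$-coloring of $G$, and is a $k$-Sudoku coloring if it extends to exactly one proper $k$-coloring of $G$. The $k$-Sudoku number $sn(G,k)$ is the smallest $|S|$ such that $G[S]$ admits a $k$-Sudoku coloring. -}

module Defs where

open import Data.Nat using (ℕ; _≤_; _⊔_; _+_)
open import Data.Bool using (Bool; true; false; T)
open import Data.Fin using (Fin)
open import Data.Fin.Subset using (Subset; _∈_; ∣_∣)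
open import Data.Vec using (tabulate; foldr′)
open import Data.Product using (Σ; _×_; ∃; ∃-syntax)
open import Relation.Binary.PropositionalEquality using (_≡_; _≢_)

record Graph (n : ℕ) : Set where
  field
    adj     : Fin n → Fin n → Bool
    symm    : ∀ u v → adj u v ≡ adj v u
    irrefl  : ∀ v → adj v v ≡ false

open Graph public

Adj : ∀ {n} → Graph n → Fin n → Fin n → Set
Adj G u v = T (adj G u v)

data Reach {n} (G : Graph n) : Fin n → Fin n → Set where
  here : ∀ {v} → Reach G v v
  step : ∀ {u w v} → Adj G u w → Reach G w v → Reach G u v

Connected : ∀ {n} → Graph n → Set
Connected {n} G = ∀ (u v : Fin n) → Reach G u v

neighbourhood : ∀ {n} → Graph n → Fin n → Subset n
neighbourhood G v = tabulate (adj G v)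

degree : ∀ {n} → Graph n → Fin n → ℕ
degree G v = ∣ neighbourhood G v ∣

maxDegree : ∀ {n} → Graph n → ℕ
maxDegree G = foldr′ _⊔_ 0 (tabulate (degree G))

Coloring : ℕ → ℕ → Set
Coloring n k = Fin n → Fin k

Proper : ∀ {n k} → Graph n → Coloring n k → Set
Proper G c = ∀ u v → Adj G u v → c u ≢ c v

IsChromaticNumber : ∀ {n} → Graph n → ℕ → Set
IsChromaticNumber {n} G χ =
  (Σ (Coloring n χ) (Proper G)) ×
  (∀ j → Σ (Coloring n j) (Proper G) → χ ≤ j)

-- A coloring of G[S]: only the values of c₀ on S are relevant.
ProperOn : ∀ {n k} → Graph n → Subset n → Coloring n k → Set
ProperOn G S c₀ = ∀ u v → u ∈ S → v ∈ S → Adj G u v → c₀ u ≢ c₀ v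

Extends : ∀ {n k} → Graph n → Subset n → Coloring n k → Coloring n k → Set
Extends G S c₀ c = Proper G c × (∀ v → v ∈ S → c v ≡ c₀ v)

IsSudokuColoring : ∀ {n k} → Graph n → Subset n → Coloring n k → Set
IsSudokuColoring {n} {k} G S c₀ =
  ProperOn G S c₀ ×
  (Σ (Coloring n k) (Extends G S c₀)) ×
  (∀ c c′ → Extends G S c₀ c → Extends G S c₀ c′ → ∀ v → c v ≡ c′ v)

IsSudokuNumber : ∀ {n} → Graph n → ℕ → ℕ → Set
IsSudokuNumber {n} G k s =
  (∃[ S ] ∃[ c₀ ] (∣ S ∣ ≡ s × IsSudokuColoring {n} {k} G S c₀)) ×
  (∀ (S : Subset n) (c₀ : Coloring n k) → IsSudokuColoring G S c₀ → s ≤ ∣ S ∣)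

{-# OPTIONS --safe #-}
-- If k ≥ Δ + 2, a vertex v left uncolored always has a color other than its own that is
-- missing from its ≤ Δ neighbours, so recoloring v gives a second extension: a Sudoku
-- coloring must color every vertex.
-- If k ≤ Δ + 1 it suffices to find a proper k-coloring c and a vertex w whose neighbours
-- carry all k − 1 colors other than c w: then c restricted to V ∖ {w} is Sudoku. Take v of
-- maximum degree and make the colors visible at v one at a time. To make a missing color a
-- visible, move every vertex of color a to a color free at it (if one has no free color,
-- it is the required w); the ≥ k − 1 neighbours of v then use at most k − 2 colors, so two
-- of them share a color, and one of these may be recolored a.
module Submission where

open import Defs
open import Data.Nat using (ℕ; zero; suc; _≤_; _<_; _+_; _∸_; _⊔_; _≤?_; z≤n; s≤s)
open import Data.Bool using (Bool; T)
open import Data.Bool.Properties using (T-≡)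
open import Data.Empty using (⊥; ⊥-elim)
open import Data.Fin using (Fin; zero; suc; inject≤; _≟_)
open import Data.Fin.Properties using (any?; inject≤-injective; suc-injective; 0≢1+n)
open import Data.Fin.Subset using (Subset; _∈_; ∣_∣; ⁅_⁆; ∁; ⊤; _-_; inside; outside)
open import Data.Fin.Subset.Properties
  using (_∈?_; ∈⊤; ∣⊤∣≡n; ∣⁅x⁆∣≡1; ∣∁p∣≡n∸∣p∣; p⊆q⇒∣p∣≤∣q∣; x∈p⇒∣p-x∣<∣p∣; x∈p∧x≢y⇒x∈p-y;
         x≢y⇒x∉⁅y⁆; x∈⁅x⁆; x∉p⇒x∈∁p; x∈∁p⇒x∉p)
open import Data.List using (List; []; _∷_; allFin)
open import Data.List.Relation.Unary.All as All using (All; []; _∷_)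
open import Data.List.Membership.Propositional.Properties using (∈-allFin)
open import Data.Nat.Properties
  using (≤-trans; ≤-reflexive; <-≤-trans; ≤-<-trans; <-irrefl; <⇒≱; ≰⇒>; ≤-pred;
         +-comm; ⊔-sel; ⊔-identityʳ; m≤m⊔n; m≤n⊔m; m≤n+m∸n; m≤n+o⇒m∸n≤o)
open import Data.Product using (Σ; ∃; ∃₂; ∃-syntax; _×_; _,_; proj₁; proj₂)
open import Data.Sum using (_⊎_; inj₁; inj₂)
open import Data.Vec using ([]; _∷_; tabulate; foldr′; here; there)
open import Data.Vec.Properties using (lookup∘tabulate; []=⇒lookup; lookup⇒[]=)
open import Data.Vec.Functional using (updateAt)
open import Data.Vec.Functional.Properties using (updateAt-updates; updateAt-minimal)
open import Function using (_∘_; const)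
open import Function.Bundles using (_⇔_; mk⇔; Equivalence)
open import Relation.Binary.PropositionalEquality using (_≡_; _≢_; refl; sym; trans; cong; subst)
open Relation.Binary.PropositionalEquality.≡-Reasoning
open import Relation.Nullary using (¬_; Dec; yes; no)
open import Relation.Nullary.Decidable using (_×-dec_; _⊎-dec_; ¬?; T?; decidable-stable)
open import Relation.Unary using (_⊆_)

injection⇒∣p∣≤∣q∣ : ∀ {m n} {p : Subset m} {q : Subset n} (f : Fin m → Fin n) →
  (∀ {x} → x ∈ p → f x ∈ q) → (∀ {x y} → x ∈ p → y ∈ p → f x ≡ f y → x ≡ y) →
  ∣ p ∣ ≤ ∣ q ∣
injection⇒∣p∣≤∣q∣ {p = []} f into inj = z≤n
injection⇒∣p∣≤∣q∣ {p = outside ∷ p} f into inj =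
  injection⇒∣p∣≤∣q∣ (f ∘ suc) (into ∘ there) (λ x∈ y∈ → suc-injective ∘ inj (there x∈) (there y∈))
injection⇒∣p∣≤∣q∣ {p = inside ∷ p} {q} f into inj = ≤-<-trans ∣p∣≤∣q-f0∣ (x∈p⇒∣p-x∣<∣p∣ (into here))
  where
  ∣p∣≤∣q-f0∣ : ∣ p ∣ ≤ ∣ q - f zero ∣
  ∣p∣≤∣q-f0∣ = injection⇒∣p∣≤∣q∣ (f ∘ suc)
    (λ x∈ → x∈p∧x≢y⇒x∈p-y (into (there x∈)) (λ eq → 0≢1+n (inj here (there x∈) (sym eq))))
    (λ x∈ y∈ → suc-injective ∘ inj (there x∈) (there y∈))

pigeonhole-on : ∀ {m n} {p : Subset m} {q : Subset n} (f : Fin m → Fin n) →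
  ∣ q ∣ < ∣ p ∣ → (∀ {x} → x ∈ p → f x ∈ q) →
  ∃₂ λ x y → x ∈ p × y ∈ p × x ≢ y × f x ≡ f y
pigeonhole-on {p = p} f ∣q∣<∣p∣ into
  with any? (λ x → any? (λ y → x ∈? p ×-dec y ∈? p ×-dec ¬? (x ≟ y) ×-dec f x ≟ f y))
... | yes collision = collision
... | no ¬collision = ⊥-elim (<⇒≱ ∣q∣<∣p∣ (injection⇒∣p∣≤∣q∣ f into injective))
  where
  injective : ∀ {x y} → x ∈ p → y ∈ p → f x ≡ f y → x ≡ y
  injective {x} {y} x∈ y∈ fx≡fy =
    decidable-stable (x ≟ y) (λ x≢y → ¬collision (x , y , x∈ , y∈ , x≢y , fx≡fy))

∣∁⁅x⁆∣≡n∸1 : ∀ {n} (x : Fin n) → ∣ ∁ ⁅ x ⁆ ∣ ≡ n ∸ 1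
∣∁⁅x⁆∣≡n∸1 {n} x = trans (∣∁p∣≡n∸∣p∣ ⁅ x ⁆) (cong (n ∸_) (∣⁅x⁆∣≡1 x))

x≢y⇒x∈∁⁅y⁆ : ∀ {n} {x y : Fin n} → x ≢ y → x ∈ ∁ ⁅ y ⁆
x≢y⇒x∈∁⁅y⁆ = x∉p⇒x∈∁p ∘ x≢y⇒x∉⁅y⁆

x∈∁⁅y⁆⇒x≢y : ∀ {n} {x y : Fin n} → x ∈ ∁ ⁅ y ⁆ → x ≢ y
x∈∁⁅y⁆⇒x≢y x∈ refl = x∈∁p⇒x∉p x∈ (x∈⁅x⁆ _)

∈-tabulate⁺ : ∀ {n} (f : Fin n → Bool) {x} → T (f x) → x ∈ tabulate f
∈-tabulate⁺ f {x} fx =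
  lookup⇒[]= x (tabulate f) (trans (lookup∘tabulate f x) (Equivalence.to T-≡ fx))

∈-tabulate⁻ : ∀ {n} (f : Fin n → Bool) {x} → x ∈ tabulate f → T (f x)
∈-tabulate⁻ f {x} x∈ = Equivalence.from T-≡ (trans (sym (lookup∘tabulate f x)) ([]=⇒lookup x∈))

≤-foldr⊔-tabulate : ∀ {n} (f : Fin n → ℕ) x → f x ≤ foldr′ _⊔_ 0 (tabulate f)
≤-foldr⊔-tabulate f zero    = m≤m⊔n _ _
≤-foldr⊔-tabulate f (suc x) = ≤-trans (≤-foldr⊔-tabulate (f ∘ suc) x) (m≤n⊔m (f zero) _)

foldr⊔-tabulate-attained : ∀ {n} (f : Fin (suc n) → ℕ) → ∃[ x ] foldr′ _⊔_ 0 (tabulate f) ≤ f x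
foldr⊔-tabulate-attained {zero} f = zero , ≤-reflexive (⊔-identityʳ (f zero))
foldr⊔-tabulate-attained {suc n} f with foldr⊔-tabulate-attained (f ∘ suc)
... | y , max≤fy with ⊔-sel (f zero) (foldr′ _⊔_ 0 (tabulate (f ∘ suc)))
...   | inj₁ max≡f0 = zero , ≤-reflexive max≡f0
...   | inj₂ max≡rest = suc y , ≤-trans (≤-reflexive max≡rest) max≤fy

_[_]≔_ : ∀ {n k} → Coloring n k → Fin n → Fin k → Coloring n k
c [ v ]≔ a = updateAt c v (const a)

recolor-at : ∀ {n k} (c : Coloring n k) v {a} → (c [ v ]≔ a) v ≡ a
recolor-at c v = updateAt-updates v c

recolor-elsewhere : ∀ {n k} {c : Coloring n k} {v a x} → x ≢ v → (c [ v ]≔ a) x ≡ c x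
recolor-elsewhere {c = c} {v} {x = x} = updateAt-minimal x v c

module _ {n : ℕ} (G : Graph n) where

  Adj-sym : ∀ {u v} → Adj G u v → Adj G v u
  Adj-sym {u} {v} = subst T (symm G u v)

  Adj⇒≢ : ∀ {u v} → Adj G u v → u ≢ v
  Adj⇒≢ {u} u~u refl = subst T (irrefl G u) u~u

  proper-≤ : ∀ {χ k} → χ ≤ k → Σ (Coloring n χ) (Proper G) → Σ (Coloring n k) (Proper G)
  proper-≤ χ≤k (c , proper) =
    (λ x → inject≤ (c x) χ≤k) , λ x y x~y → proper x y x~y ∘ inject≤-injective χ≤k χ≤k (c x) (c y)

  forced⇒sudoku : ∀ {k S} {c : Coloring n k} → Proper G c →
    (∀ c′ → Extends G S c c′ → ∀ x → c′ x ≡ c x) → IsSudokuColoring G S c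
  forced⇒sudoku {c = c} proper forced =
    (λ u v _ _ → proper u v) , (c , proper , λ _ _ → refl) ,
    λ c′ c″ ext′ ext″ x → trans (forced c′ ext′ x) (sym (forced c″ ext″ x))

  full-sudoku : ∀ {k} {c : Coloring n k} → Proper G c → IsSudokuColoring G ⊤ c
  full-sudoku proper = forced⇒sudoku proper (λ c′ ext x → proj₂ ext x ∈⊤)

  module _ {k : ℕ} where

    Sees : Coloring n k → Fin n → Fin k → Set
    Sees c v a = ∃[ u ] Adj G v u × c u ≡ a

    sees? : ∀ c v a → Dec (Sees c v a)
    sees? c v a = any? (λ u → T? (adj G v u) ×-dec c u ≟ a)

    Free : Coloring n k → Fin n → Fin k → Set
    Free c v a = a ≢ c v × ¬ Sees c v a

    free? : ∀ c v → Dec (∃ (Free c v))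
    free? c v = any? (λ a → ¬? (a ≟ c v) ×-dec ¬? (sees? c v a))

    Saturated : Coloring n k → Fin n → Set
    Saturated c v = ∀ a → a ≢ c v → Sees c v a

    ¬free⇒saturated : ∀ {c v} → ¬ ∃ (Free c v) → Saturated c v
    ¬free⇒saturated {c} {v} ¬free a a≢cv =
      decidable-stable (sees? c v a) (λ ¬sees → ¬free (a , a≢cv , ¬sees))

    Visible : Coloring n k → Fin n → Fin k → Set
    Visible c v a = a ≡ c v ⊎ Sees c v a

    visible? : ∀ c v a → Dec (Visible c v a)
    visible? c v a = (a ≟ c v) ⊎-dec sees? c v a

    SaturatedColoring : Set
    SaturatedColoring = Σ (Coloring n k) λ c → Proper G c × ∃ (Saturated c)

    saturated⇒sudoku : ∀ {c w} → Proper G c → Saturated c w → IsSudokuColoring G (∁ ⁅ w ⁆) c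
    saturated⇒sudoku {c} {w} proper saturated = forced⇒sudoku proper forced
      where
      forced : ∀ c′ → Extends G (∁ ⁅ w ⁆) c c′ → ∀ x → c′ x ≡ c x
      forced c′ (proper′ , agrees) x with x ≟ w
      ... | no x≢w = agrees x (x≢y⇒x∈∁⁅y⁆ x≢w)
      ... | yes refl = decidable-stable (c′ x ≟ c x) clash
        where
        clash : c′ x ≢ c x → ⊥
        clash c′x≢cx with saturated (c′ x) c′x≢cx
        ... | u , x~u , cu≡c′x =
          proper′ x u x~u (sym (trans (agrees u (x≢y⇒x∈∁⁅y⁆ (Adj⇒≢ x~u ∘ sym))) cu≡c′x))

    recolor-proper : ∀ {c v a} → Proper G c → ¬ Sees c v a → Proper G (c [ v ]≔ a)
    recolor-proper {c} {v} proper ¬sees x y x~y with x ≟ v | y ≟ v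
    ... | yes refl | yes refl = ⊥-elim (Adj⇒≢ x~y refl)
    ... | yes refl | no y≢v = λ a≡c′y →
      ¬sees (y , x~y , trans (sym (recolor-elsewhere y≢v)) (trans (sym a≡c′y) (recolor-at c x)))
    ... | no x≢v | yes refl = λ c′x≡a →
      ¬sees (x , Adj-sym x~y , trans (sym (recolor-elsewhere x≢v)) (trans c′x≡a (recolor-at c y)))
    ... | no x≢v | no y≢v = λ c′x≡c′y →
      proper x y x~y (trans (sym (recolor-elsewhere x≢v)) (trans c′x≡c′y (recolor-elsewhere y≢v)))

    saturated⇒≤1+degree : ∀ {c v} → Saturated c v → k ≤ suc (degree G v)
    saturated⇒≤1+degree {c} {v} saturated = ≤-trans (m≤n+m∸n k 1) (s≤s k∸1≤degree)
      where
      neighbour : Fin k → Fin n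
      neighbour a with a ≟ c v
      ... | yes _ = v
      ... | no a≢cv = proj₁ (saturated a a≢cv)
      neighbour-sees : ∀ {a} → a ∈ ∁ ⁅ c v ⁆ → Adj G v (neighbour a) × c (neighbour a) ≡ a
      neighbour-sees {a} a∈ with a ≟ c v
      ... | yes a≡cv = ⊥-elim (x∈∁⁅y⁆⇒x≢y a∈ a≡cv)
      ... | no a≢cv = proj₂ (saturated a a≢cv)
      k∸1≤degree : k ∸ 1 ≤ degree G v
      k∸1≤degree = subst (_≤ degree G v) (∣∁⁅x⁆∣≡n∸1 (c v)) (injection⇒∣p∣≤∣q∣ neighbour
        (∈-tabulate⁺ (adj G v) ∘ proj₁ ∘ neighbour-sees)
        (λ a∈ b∈ eq →
          trans (sym (proj₂ (neighbour-sees a∈))) (trans (cong c eq) (proj₂ (neighbour-sees b∈)))))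

    neighbours-share-color : ∀ {c : Coloring n k} {v a} →
      k ≤ suc (degree G v) → Proper G c → (∀ x → c x ≢ a) →
      ∃₂ λ u₁ u₂ → Adj G v u₁ × Adj G v u₂ × u₁ ≢ u₂ × c u₁ ≡ c u₂
    neighbours-share-color {c} {v} {a} k≤1+degree proper a-unused
      with pigeonhole-on c ∣q∣<degree into
      where
      ∣q∣<degree : ∣ ∁ ⁅ c v ⁆ - a ∣ < degree G v
      ∣q∣<degree = <-≤-trans (x∈p⇒∣p-x∣<∣p∣ (x≢y⇒x∈∁⁅y⁆ (a-unused v ∘ sym)))
        (≤-trans (≤-reflexive (∣∁⁅x⁆∣≡n∸1 (c v))) (m≤n+o⇒m∸n≤o k 1 k≤1+degree))
      into : ∀ {u} → u ∈ neighbourhood G v → c u ∈ ∁ ⁅ c v ⁆ - a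
      into {u} u∈ =
        x∈p∧x≢y⇒x∈p-y (x≢y⇒x∈∁⁅y⁆ (proper v u (∈-tabulate⁻ (adj G v) u∈) ∘ sym)) (a-unused u)
    ... | u₁ , u₂ , u₁∈ , u₂∈ , u₁≢u₂ , same =
      u₁ , u₂ , ∈-tabulate⁻ (adj G v) u₁∈ , ∈-tabulate⁻ (adj G v) u₂∈ , u₁≢u₂ , same

    module Evacuate {c : Coloring n k} (proper : Proper G c) (a : Fin k)
                    (free : ∀ x → c x ≡ a → ∃ (Free c x)) where

      move : ∀ x → Dec (c x ≡ a) → Fin k
      move x (yes cx≡a) = proj₁ (free x cx≡a)
      move x (no _)     = c x

      evacuated : Coloring n k
      evacuated x = move x (c x ≟ a)

      move-≢ : ∀ x d → move x d ≢ a
      move-≢ x (yes cx≡a) b≡a = proj₁ (proj₂ (free x cx≡a)) (trans b≡a (sym cx≡a))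
      move-≢ x (no cx≢a)      = cx≢a

      move-fixes : ∀ x d → c x ≢ a → move x d ≡ c x
      move-fixes x (yes cx≡a) cx≢a = ⊥-elim (cx≢a cx≡a)
      move-fixes x (no _)     _    = refl

      move-proper : ∀ {x y} → Adj G x y → ∀ dx dy → move x dx ≢ move y dy
      move-proper x~y (yes cx≡a) (yes cy≡a) _  = proper _ _ x~y (trans cx≡a (sym cy≡a))
      move-proper x~y (yes cx≡a) (no _)     eq = proj₂ (proj₂ (free _ cx≡a)) (_ , x~y , sym eq)
      move-proper x~y (no _)     (yes cy≡a) eq = proj₂ (proj₂ (free _ cy≡a)) (_ , Adj-sym x~y , eq)
      move-proper x~y (no _)     (no _)        = proper _ _ x~y

    evacuate-or-saturated : ∀ {c} → Proper G c → ∀ a → SaturatedColoring ⊎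
      ∃[ c₁ ] Proper G c₁ × (∀ x → c₁ x ≢ a) × (∀ x → c x ≢ a → c₁ x ≡ c x)
    evacuate-or-saturated {c} proper a with any? (λ x → c x ≟ a ×-dec ¬? (free? c x))
    ... | yes (x , _ , ¬free) = inj₁ (c , proper , x , ¬free⇒saturated ¬free)
    ... | no ¬stuck = inj₂ (evacuated , (λ x y x~y → move-proper x~y (c x ≟ a) (c y ≟ a)) ,
                            (λ x → move-≢ x (c x ≟ a)) , (λ x → move-fixes x (c x ≟ a)))
      where
      open Evacuate proper a
        (λ x cx≡a → decidable-stable (free? c x) (λ ¬free → ¬stuck (x , cx≡a , ¬free)))

    module _ {v : Fin n} (k≤1+degree : k ≤ suc (degree G v)) where

      visible-grows : ∀ {c a} → Proper G c → Free c v a → SaturatedColoring ⊎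
        ∃[ c′ ] Proper G c′ × Visible c′ v a × Visible c v ⊆ Visible c′ v
      visible-grows {c} {a} proper (a≢cv , ¬sees) with evacuate-or-saturated proper a
      ... | inj₁ saturated = inj₁ saturated
      ... | inj₂ (c₁ , proper₁ , a-unused , c₁-fixes)
        with neighbours-share-color k≤1+degree proper₁ a-unused
      ...   | u₁ , u₂ , v~u₁ , v~u₂ , u₁≢u₂ , same =
        inj₂ (c₁ [ u₁ ]≔ a , recolor-proper proper₁ (λ (u , _ , c₁u≡a) → a-unused u c₁u≡a) ,
              inj₂ (u₁ , v~u₁ , recolor-at c₁ u₁) , grows)
        where
        neighbour-fixed : ∀ {u} → Adj G v u → c₁ u ≡ c u
        neighbour-fixed {u} v~u = c₁-fixes u (λ cu≡a → ¬sees (u , v~u , cu≡a))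
        grows : Visible c v ⊆ Visible (c₁ [ u₁ ]≔ a) v
        grows (inj₁ b≡cv) =
          inj₁ (trans b≡cv (sym (trans (recolor-elsewhere (Adj⇒≢ v~u₁)) (c₁-fixes v (a≢cv ∘ sym)))))
        grows {b} (inj₂ (u , v~u , cu≡b)) with u ≟ u₁
        ... | yes refl = inj₂ (u₂ , v~u₂ , (begin
          (c₁ [ u₁ ]≔ a) u₂  ≡⟨ recolor-elsewhere (u₁≢u₂ ∘ sym) ⟩
          c₁ u₂              ≡⟨ same ⟨
          c₁ u₁              ≡⟨ neighbour-fixed v~u ⟩
          c u₁               ≡⟨ cu≡b ⟩
          b                  ∎))
        ... | no u≢u₁ =
          inj₂ (u , v~u , trans (recolor-elsewhere u≢u₁) (trans (neighbour-fixed v~u) cu≡b))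

      make-visible : ∀ {c} → Proper G c → (as : List (Fin k)) →
        SaturatedColoring ⊎ ∃[ c′ ] Proper G c′ × All (Visible c′ v) as
      make-visible proper [] = inj₂ (_ , proper , [])
      make-visible proper (a ∷ as) with make-visible proper as
      ... | inj₁ saturated = inj₁ saturated
      ... | inj₂ (c , proper′ , visible) with visible? c v a
      ...   | yes a-visible = inj₂ (c , proper′ , a-visible ∷ visible)
      ...   | no a-invisible with visible-grows proper′ (a-invisible ∘ inj₁ , a-invisible ∘ inj₂)
      ...     | inj₁ saturated = inj₁ saturated
      ...     | inj₂ (c′ , proper″ , a-visible , grows) =
        inj₂ (c′ , proper″ , a-visible ∷ All.map grows visible)

      saturated-coloring : Σ (Coloring n k) (Proper G) → SaturatedColoring
      saturated-coloring (c , proper) with make-visible proper (allFin k)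
      ... | inj₁ saturated = saturated
      ... | inj₂ (c′ , proper′ , visible) = c′ , proper′ , v , saturated
        where
        saturated : Saturated c′ v
        saturated a a≢c′v with All.lookup visible (∈-allFin a)
        ... | inj₁ a≡c′v = ⊥-elim (a≢c′v a≡c′v)
        ... | inj₂ sees = sees

    low-degree⇒∈support : ∀ {S c₀ v} → suc (degree G v) < k → IsSudokuColoring G S c₀ → v ∈ S
    low-degree⇒∈support {S} {c₀} {v} 1+degree<k (_ , (c , proper , agrees) , unique) with v ∈? S
    ... | yes v∈S = v∈S
    ... | no v∉S with free? c v
    ...   | no ¬free = ⊥-elim (<⇒≱ 1+degree<k (saturated⇒≤1+degree (¬free⇒saturated ¬free)))
    ...   | yes (b , b≢cv , ¬sees) = ⊥-elim (b≢cv (begin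
      b                ≡⟨ recolor-at c v ⟨
      (c [ v ]≔ b) v   ≡⟨ unique c (c [ v ]≔ b) (proper , agrees) (proper′ , agrees′) v ⟨
      c v              ∎))
      where
      proper′ : Proper G (c [ v ]≔ b)
      proper′ = recolor-proper proper ¬sees
      agrees′ : ∀ x → x ∈ S → (c [ v ]≔ b) x ≡ c₀ x
      agrees′ x x∈S = trans (recolor-elsewhere (λ x≡v → v∉S (subst (_∈ S) x≡v x∈S))) (agrees x x∈S)

k<Δ+2⇒sudoku-leaving-one-vertex : ∀ {n k} (G : Graph (suc n)) → k < maxDegree G + 2 →
  Σ (Coloring (suc n) k) (Proper G) → ∃[ S ] ∃[ c ] ∣ S ∣ ≡ n × IsSudokuColoring G S c
k<Δ+2⇒sudoku-leaving-one-vertex {k = k} G k<Δ+2 coloring with foldr⊔-tabulate-attained (degree G)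
... | v , Δ≤degree with saturated-coloring G k≤1+degree coloring
  where
  k≤1+degree : k ≤ suc (degree G v)
  k≤1+degree = ≤-pred (≤-trans k<Δ+2
    (≤-trans (≤-reflexive (+-comm (maxDegree G) 2)) (s≤s (s≤s Δ≤degree))))
...   | c , proper , w , saturated =
  ∁ ⁅ w ⁆ , c , ∣∁⁅x⁆∣≡n∸1 w , saturated⇒sudoku G proper saturated

Δ+2≤k⇒sudoku-support-full : ∀ {n k} (G : Graph n) → maxDegree G + 2 ≤ k →
  ∀ S (c₀ : Coloring n k) → IsSudokuColoring G S c₀ → n ≤ ∣ S ∣
Δ+2≤k⇒sudoku-support-full {n} {k} G Δ+2≤k S c₀ sudoku =
  subst (_≤ ∣ S ∣) (∣⊤∣≡n n)
    (p⊆q⇒∣p∣≤∣q∣ {p = ⊤} (λ {v} _ → low-degree⇒∈support G (1+degree<k v) sudoku))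
  where
  1+degree<k : ∀ v → suc (degree G v) < k
  1+degree<k v = ≤-trans (s≤s (s≤s (≤-foldr⊔-tabulate (degree G) v)))
                         (≤-trans (≤-reflexive (+-comm 2 (maxDegree G))) Δ+2≤k)

mainTheorem3 : ∀ (n : ℕ) (G : Graph n) → 1 ≤ n → Connected G →
    ∀ (χ k : ℕ) → IsChromaticNumber G χ → χ ≤ k →
    (IsSudokuNumber G k n ⇔ maxDegree G + 2 ≤ k)
mainTheorem3 (suc n) G _ _ χ k (χ-coloring , _) χ≤k = mk⇔ necessary sufficient
  where
  coloring : Σ (Coloring (suc n) k) (Proper G)
  coloring = proper-≤ G χ≤k χ-coloring

  necessary : IsSudokuNumber G k (suc n) → maxDegree G + 2 ≤ k
  necessary (_ , minimal) with maxDegree G + 2 ≤? k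
  ... | yes Δ+2≤k = Δ+2≤k
  ... | no Δ+2≰k with k<Δ+2⇒sudoku-leaving-one-vertex G (≰⇒> Δ+2≰k) coloring
  ...   | S , c , ∣S∣≡n , sudoku = ⊥-elim (<-irrefl (sym ∣S∣≡n) (minimal S c sudoku))

  sufficient : maxDegree G + 2 ≤ k → IsSudokuNumber G k (suc n)
  sufficient Δ+2≤k = (⊤ , proj₁ coloring , ∣⊤∣≡n (suc n) , full-sudoku G (proj₂ coloring)) ,
                     Δ+2≤k⇒sudoku-support-full G Δ+2≤k
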